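{- Let $x^*$ be an optimal solution of (L.P.1), let $J$ be a spanning tree of $G$ appearing in a decomposition $x^*=\sum_i\lambda_i\chi(J_i)$ of $x^*$ as a convex combination of incidence vectors of spanning trees, and let $D$ be the set of nodes of wrong degree in $J$. Let $\alpha\ge 0$ and $\beta>0$ with $\alpha+2\beta\ge 1$. Then $(\alpha\chi(J)+\beta x^*)(\delta(U))\ge 1$ for every $U\subseteq V$ that is either (i) $T$-even, with $\emptyset\neq U\subsetneq V$, or (ii) $T$-odd and $D$-odd with $x^*(\delta(U))\ge \frac{1-2\alpha}{\beta}$.
   Context: $G=(V,E)$ is a graph with nonnegative edge costs $c_e$, $T\subseteq V$ with $|T|$ even. (L.P.1) is: minimize $\sum_e c_ex_e$ subject to $x(E(S))\le|S|-1$ for all $S\subsetneq V$, $|S|\ge 2$; $x(E(V))=|V|-1$; $x(\delta(S))\ge 2$ for all $\emptyset\ne S\subsetneq V$ with $|S\cap T|$ even; $x\ge 0$. Here $E(S)$ is the set of edges with both ends in $S$, $\delta(S)$ the set of edges with exactly one end in $S$, $x(A)=\sum_{e\in A}x_e$, $\chi(J)$ is the 0-1 incidence vector of $J$. A set $U$ is $T$-odd/$T$-even if $|U\cap T|$ is odd/even, similarly for $D$. The wrong-degree set $D$ of $J$ consists of the nodes of $T$ with even degree in $J$ and the nodes of $V\setminus T$ with odd degree in $J$. -}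

module Defs where

open import Data.Nat using (ℕ; zero; suc; _∸_)
open import Data.Integer using (+_)
open import Data.Fin using (Fin; zero; suc)
open import Data.Fin.Properties using (_≟_)
open import Data.Bool using (Bool; true; false; if_then_else_; _∧_; _∨_; not; _xor_)
open import Data.Product using (Σ; _×_; _,_; proj₁; proj₂; ∃)
open import Relation.Nullary.Decidable using (⌊_⌋)
open import Relation.Binary.PropositionalEquality using (_≡_)
open import Relation.Nullary using (¬_)
open import Data.Rational using (ℚ; 0ℚ; 1ℚ; _+_; _*_; _-_; _≤_; _<_; _/_; _÷_; positive)
open import Data.Rational.Properties using (pos⇒nonZero)

sumℚ : (k : ℕ) → (Fin k → ℚ) → ℚ
sumℚ zero    f = 0ℚ
sumℚ (suc k) f = f zero + sumℚ k (λ i → f (suc i))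

sumℕ : (k : ℕ) → (Fin k → ℕ) → ℕ
sumℕ zero    f = 0
sumℕ (suc k) f = f zero Data.Nat.+ sumℕ k (λ i → f (suc i))

ℕ→ℚ : ℕ → ℚ
ℕ→ℚ k = + k / 1

divPos : (p q : ℚ) → 0ℚ < q → ℚ
divPos p q h = _÷_ p q {{pos⇒nonZero q {{positive h}}}}

b2n : Bool → ℕ
b2n true  = 1
b2n false = 0

isEven : ℕ → Bool
isEven zero          = true
isEven (suc zero)    = false
isEven (suc (suc k)) = isEven k

record Graph : Set where
  field
    n    : ℕ
    m    : ℕ
    ends : Fin m → Fin n × Fin n

module _ (G : Graph) where
  open Graph G

  NodeSet : Set
  NodeSet = Fin n → Bool

  EdgeSet : Set
  EdgeSet = Fin m → Bool

  EdgeVec : Set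
  EdgeVec = Fin m → ℚ

  ∣_∣ᵥ : NodeSet → ℕ
  ∣ S ∣ᵥ = sumℕ n (λ v → b2n (S v))

  cardInter : NodeSet → NodeSet → ℕ
  cardInter S A = sumℕ n (λ v → b2n (S v ∧ A v))

  tail head : Fin m → Fin n
  tail e = proj₁ (ends e)
  head e = proj₂ (ends e)

  E[_] : NodeSet → EdgeSet
  E[ S ] e = S (tail e) ∧ S (head e)

  δ[_] : NodeSet → EdgeSet
  δ[ S ] e = S (tail e) xor S (head e)

  _⟦_⟧ : EdgeVec → EdgeSet → ℚ
  x ⟦ A ⟧ = sumℚ m (λ e → if A e then x e else 0ℚ)

  χ : EdgeSet → EdgeVec
  χ J e = if J e then 1ℚ else 0ℚ

  allV : NodeSet
  allV _ = true

  Nonempty Proper : NodeSet → Set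
  Nonempty S = ∃ λ v → S v ≡ true
  Proper   S = ∃ λ v → S v ≡ false

  data Reach (F : EdgeSet) : Fin n → Fin n → Set where
    here : ∀ {u} → Reach F u u
    fwd  : ∀ {u w} e → F e ≡ true → tail e ≡ u → Reach F (head e) w → Reach F u w
    bwd  : ∀ {u w} e → F e ≡ true → head e ≡ u → Reach F (tail e) w → Reach F u w

  _∖ₑ_ : EdgeSet → Fin m → EdgeSet
  (J ∖ₑ e) f = J f ∧ not ⌊ e ≟ f ⌋

  Connected : EdgeSet → Set
  Connected J = ∀ u v → Reach J u v

  -- acyclic: no edge of J lies on a cycle of J, i.e. the ends of each
  -- edge e ∈ J are not joined by a walk in J − e (this also excludes loops)
  Acyclic : EdgeSet → Set
  Acyclic J = ∀ e → J e ≡ true → ¬ Reach (J ∖ₑ e) (tail e) (head e)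

  SpanningTree : EdgeSet → Set
  SpanningTree J = Connected J × Acyclic J

  -- degree of v in J (a loop would count twice)
  deg : EdgeSet → Fin n → ℕ
  deg J v = sumℕ m (λ e → b2n (J e) Data.Nat.* (b2n ⌊ tail e ≟ v ⌋ Data.Nat.+ b2n ⌊ head e ≟ v ⌋))

  wrongDeg : NodeSet → EdgeSet → NodeSet
  wrongDeg T J v = if T v then isEven (deg J v) else not (isEven (deg J v))

  TEven TOdd : NodeSet → NodeSet → Set
  TEven T U = isEven (cardInter U T) ≡ true
  TOdd  T U = isEven (cardInter U T) ≡ false

  record LP1Feasible (T : NodeSet) (x : EdgeVec) : Set where
    field
      subtour : ∀ (S : NodeSet) → Proper S → Data.Nat._≤_ 2 ∣ S ∣ᵥ →
                x ⟦ E[ S ] ⟧ ≤ ℕ→ℚ (∣ S ∣ᵥ ∸ 1)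
      total   : x ⟦ E[ allV ] ⟧ ≡ ℕ→ℚ (n ∸ 1)
      cut     : ∀ (S : NodeSet) → Nonempty S → Proper S → TEven T S →
                ℕ→ℚ 2 ≤ x ⟦ δ[ S ] ⟧
      nonneg  : ∀ e → 0ℚ ≤ x e

  cost : EdgeVec → EdgeVec → ℚ
  cost c x = sumℚ m (λ e → c e * x e)

  LP1Optimal : EdgeVec → NodeSet → EdgeVec → Set
  LP1Optimal c T x = LP1Feasible T x × (∀ y → LP1Feasible T y → cost c x ≤ cost c y)

  record AppearsInTreeDecomp (x : EdgeVec) (J : EdgeSet) : Set where
    field
      k      : ℕ
      λs     : Fin k → ℚ
      trees  : Fin k → EdgeSet
      isTree : ∀ i → SpanningTree (trees i)
      λpos   : ∀ i → 0ℚ < λs i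
      λsum   : sumℚ k λs ≡ 1ℚ
      decomp : ∀ e → x e ≡ sumℚ k (λ i → λs i * χ (trees i) e)
      index  : Fin k
      isJ    : ∀ e → trees index e ≡ J e

-- J is a spanning tree (it appears in the decomposition), so it has an edge in
-- every cut δ(U) with ∅ ≠ U ≠ V.  If U is T-even, (L.P.1) gives x*(δ(U)) ≥ 2,
-- hence the value is at least α + 2β ≥ 1.  If U is T-odd, then U and V ∖ U are
-- nonempty because T is even; summing degrees over U counts |J ∩ δ(U)| modulo 2,
-- and a node of U is in D exactly when its degree parity disagrees with its
-- membership in T, so for a D-odd U the cut J ∩ δ(U) is even, hence at least 2.
-- The value is then at least 2α + β·(1 − 2α)/β = 1.
module Submission where

open import Defs
open import Data.Nat using (ℕ)
open import Data.Bool using (Bool)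
open import Data.Product using (_×_)
open import Data.Sum using (_⊎_)
open import Relation.Binary.PropositionalEquality using (_≡_)
open import Data.Rational using (ℚ; 0ℚ; 1ℚ; _+_; _*_; _-_; _≤_; _<_)

open import Algebra.Bundles using (Monoid; CommutativeRing)
open import Data.Bool using (true; false; not; _∧_; _xor_; if_then_else_)
open import Data.Bool.Properties
  using (xor-∧-commutativeRing; not-involutive; not-injective; not-distribˡ-xor;
         true-xor; xor-identityʳ; xor-inverseʳ; ∧-distribˡ-xor; ∧-distribʳ-xor)
open import Data.Bool.Solver using (module xor-∧-Solver)
open import Data.Fin using (Fin; zero; suc)
open import Data.Fin.Properties using (_≟_; suc-injective)
import Data.Nat as ℕ
import Data.Nat.Properties as ℕ
open import Data.Product using (_,_; proj₁; ∃)
open import Data.Rational.Base using (1/_; nonNegative; positive)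
import Data.Rational.Properties as ℚ
open import Data.Rational.Solver using (module +-*-Solver)
open import Data.Sum using (inj₁; inj₂)
open import Relation.Binary.PropositionalEquality
  using (refl; sym; trans; cong; cong₂; module ≡-Reasoning)
open import Relation.Nullary.Decidable using (⌊_⌋; ⌊⌋-map′)

open import Algebra.Definitions.RawMonoid (Monoid.rawMonoid ℚ.+-0-monoid)
  using () renaming (_×_ to _×ℚ_)
-- ∑ is summation in the Boolean ring (Bool, xor, ∧): the parity of a count.
open import Algebra.Properties.Semiring.Sum (CommutativeRing.semiring xor-∧-commutativeRing)
  using (sum-syntax; sum-cong-≗; sum-replicate-zero; ∑-distrib-+; ∑-comm; *-distribˡ-sum)

parity : ℕ → Bool
parity ℕ.zero    = false
parity (ℕ.suc k) = not (parity k)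

isEven≡not-parity : ∀ k → isEven k ≡ not (parity k)
isEven≡not-parity ℕ.zero            = refl
isEven≡not-parity (ℕ.suc ℕ.zero)    = refl
isEven≡not-parity (ℕ.suc (ℕ.suc k)) = trans (isEven≡not-parity k) (sym (not-involutive _))

parity-+ : ∀ a b → parity (a ℕ.+ b) ≡ parity a xor parity b
parity-+ ℕ.zero    b = refl
parity-+ (ℕ.suc a) b = trans (cong not (parity-+ a b)) (not-distribˡ-xor (parity a) (parity b))

parity-b2n : ∀ b → parity (b2n b) ≡ b
parity-b2n true  = refl
parity-b2n false = refl

parity-b2n-* : ∀ b k → parity (b2n b ℕ.* k) ≡ b ∧ parity k
parity-b2n-* true  k = cong parity (ℕ.+-identityʳ k)
parity-b2n-* false k = refl

parity-sumℕ : ∀ k (f : Fin k → ℕ) → parity (sumℕ k f) ≡ ∑[ i < k ] parity (f i)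
parity-sumℕ ℕ.zero    f = refl
parity-sumℕ (ℕ.suc k) f =
  trans (parity-+ (f zero) _) (cong (parity (f zero) xor_) (parity-sumℕ k (λ i → f (suc i))))

parity-count : ∀ k (f : Fin k → Bool) → parity (sumℕ k (λ i → b2n (f i))) ≡ ∑[ i < k ] f i
parity-count k f = trans (parity-sumℕ k _) (sum-cong-≗ (λ i → parity-b2n (f i)))

count-pos : ∀ k (f : Fin k → Bool) i → f i ≡ true → 1 ℕ.≤ sumℕ k (λ j → b2n (f j))
count-pos (ℕ.suc k) f zero    fi rewrite fi = ℕ.s≤s ℕ.z≤n
count-pos (ℕ.suc k) f (suc i) fi =
  ℕ.≤-trans (count-pos k (λ j → f (suc j)) i fi) (ℕ.m≤n+m _ (b2n (f zero)))

1≤even⇒2≤ : ∀ {k} → 1 ℕ.≤ k → parity k ≡ false → 2 ℕ.≤ k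
1≤even⇒2≤ {ℕ.suc ℕ.zero}    _ ()
1≤even⇒2≤ {ℕ.suc (ℕ.suc k)} _ _ = ℕ.s≤s (ℕ.s≤s ℕ.z≤n)

∑-indicator : ∀ {n} (w : Fin n) (g : Fin n → Bool) → ∑[ v < n ] (⌊ w ≟ v ⌋ ∧ g v) ≡ g w
∑-indicator {ℕ.suc n} zero g =
  trans (cong (g zero xor_) (sum-replicate-zero n)) (xor-identityʳ (g zero))
∑-indicator {ℕ.suc n} (suc w) g =
  trans (sum-cong-≗ (λ v → cong (_∧ g (suc v)) (⌊⌋-map′ (cong suc) suc-injective (w ≟ v))))
        (∑-indicator w (λ v → g (suc v)))

∑≡true⇒∃ : ∀ k (f : Fin k → Bool) → ∑[ i < k ] f i ≡ true → ∃ λ i → f i ≡ true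
∑≡true⇒∃ ℕ.zero    f ()
∑≡true⇒∃ (ℕ.suc k) f h with f zero in eq
... | true  = zero , eq
... | false = let (i , p) = ∑≡true⇒∃ k (λ i → f (suc i)) h in suc i , p

∧-true⇒ˡ : ∀ {a b} → (a ∧ b) ≡ true → a ≡ true
∧-true⇒ˡ {true} _ = refl

×ℚ1-nonNeg : ∀ k → 0ℚ ≤ k ×ℚ 1ℚ
×ℚ1-nonNeg ℕ.zero    = ℚ.≤-refl
×ℚ1-nonNeg (ℕ.suc k) = ℚ.+-mono-≤ (ℚ.<⇒≤ (ℚ.positive⁻¹ 1ℚ)) (×ℚ1-nonNeg k)

×ℚ1-mono-≤ : ∀ {k l} → k ℕ.≤ l → k ×ℚ 1ℚ ≤ l ×ℚ 1ℚ
×ℚ1-mono-≤ {l = l} ℕ.z≤n = ×ℚ1-nonNeg l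
×ℚ1-mono-≤ (ℕ.s≤s k≤l)  = ℚ.+-monoʳ-≤ 1ℚ (×ℚ1-mono-≤ k≤l)

sumℚ-indicator : ∀ k (f : Fin k → Bool) →
  sumℚ k (λ i → if f i then 1ℚ else 0ℚ) ≡ sumℕ k (λ i → b2n (f i)) ×ℚ 1ℚ
sumℚ-indicator ℕ.zero    f = refl
sumℚ-indicator (ℕ.suc k) f with f zero
... | true  = cong (1ℚ +_) (sumℚ-indicator k (λ i → f (suc i)))
... | false = trans (ℚ.+-identityˡ _) (sumℚ-indicator k (λ i → f (suc i)))

sumℚ-cong : ∀ k {f g : Fin k → ℚ} → (∀ i → f i ≡ g i) → sumℚ k f ≡ sumℚ k g
sumℚ-cong ℕ.zero    h = refl
sumℚ-cong (ℕ.suc k) h = cong₂ _+_ (h zero) (sumℚ-cong k (λ i → h (suc i)))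

sumℚ-linear : ∀ k a b (f g : Fin k → ℚ) →
  sumℚ k (λ i → a * f i + b * g i) ≡ a * sumℚ k f + b * sumℚ k g
sumℚ-linear ℕ.zero    a b f g = sym (cong₂ _+_ (ℚ.*-zeroʳ a) (ℚ.*-zeroʳ b))
sumℚ-linear (ℕ.suc k) a b f g = begin
  (a * f zero + b * g zero) + sumℚ k (λ i → a * f (suc i) + b * g (suc i))
    ≡⟨ cong ((a * f zero + b * g zero) +_) (sumℚ-linear k a b (λ i → f (suc i)) (λ i → g (suc i))) ⟩
  (a * f zero + b * g zero) + (a * Σf + b * Σg)
    ≡⟨ regroup a b (f zero) (g zero) Σf Σg ⟩
  a * (f zero + Σf) + b * (g zero + Σg) ∎
  where
  Σf Σg : ℚ
  Σf = sumℚ k (λ i → f (suc i))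
  Σg = sumℚ k (λ i → g (suc i))
  open ≡-Reasoning
  open +-*-Solver
  regroup : ∀ a b f g F G → (a * f + b * g) + (a * F + b * G) ≡ a * (f + F) + b * (g + G)
  regroup = solve 6 (λ a b f g F G →
    (a :* f :+ b :* g) :+ (a :* F :+ b :* G) := a :* (f :+ F) :+ b :* (g :+ G)) refl

module _ (G : Graph) where
  open Graph G
  open ≡-Reasoning

  edgeCount : EdgeSet G → ℕ
  edgeCount F = sumℕ m (λ e → b2n (F e))

  ⟦⟧-linear : ∀ a b (y z : EdgeVec G) (A : EdgeSet G) →
    _⟦_⟧ G (λ e → a * y e + b * z e) A ≡ a * _⟦_⟧ G y A + b * _⟦_⟧ G z A
  ⟦⟧-linear a b y z A = trans (sumℚ-cong m restrict-linear) (sumℚ-linear m a b _ _)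
    where
    restrict-linear : ∀ e → (if A e then a * y e + b * z e else 0ℚ)
                          ≡ a * (if A e then y e else 0ℚ) + b * (if A e then z e else 0ℚ)
    restrict-linear e with A e
    ... | true  = refl
    ... | false = sym (cong₂ _+_ (ℚ.*-zeroʳ a) (ℚ.*-zeroʳ b))

  χ⟦⟧≡edgeCount : ∀ (J A : EdgeSet G) → _⟦_⟧ G (χ G J) A ≡ edgeCount (λ e → J e ∧ A e) ×ℚ 1ℚ
  χ⟦⟧≡edgeCount J A = trans (sumℚ-cong m restrict-χ) (sumℚ-indicator m _)
    where
    restrict-χ : ∀ e → (if A e then χ G J e else 0ℚ) ≡ (if J e ∧ A e then 1ℚ else 0ℚ)
    restrict-χ e with J e | A e
    ... | true  | true  = refl
    ... | true  | false = refl
    ... | false | true  = refl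
    ... | false | false = refl

  Reach-mono : ∀ {F F′ : EdgeSet G} → (∀ e → F e ≡ true → F′ e ≡ true) →
               ∀ {u w} → Reach G F u w → Reach G F′ u w
  Reach-mono F⊆F′ here          = here
  Reach-mono F⊆F′ (fwd e p q r) = fwd e (F⊆F′ e p) q (Reach-mono F⊆F′ r)
  Reach-mono F⊆F′ (bwd e p q r) = bwd e (F⊆F′ e p) q (Reach-mono F⊆F′ r)

  Reach⇒δ-edge : ∀ {F : EdgeSet G} (U : NodeSet G) {u w} → Reach G F u w →
                 U u ≡ true → U w ≡ false → ∃ λ e → (F e ∧ δ[_] G U e) ≡ true
  Reach⇒δ-edge U here Uu Uw with trans (sym Uu) Uw
  ... | ()
  Reach⇒δ-edge {F} U (fwd e Fe refl r) Uu Uw with U (head G e) in Uh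
  ... | true  = Reach⇒δ-edge U r Uh Uw
  ... | false = e , crossing
    where
    crossing : (F e ∧ (U (tail G e) xor U (head G e))) ≡ true
    crossing rewrite Fe | Uu | Uh = refl
  Reach⇒δ-edge {F} U (bwd e Fe refl r) Uu Uw with U (tail G e) in Ut
  ... | true  = Reach⇒δ-edge U r Ut Uw
  ... | false = e , crossing
    where
    crossing : (F e ∧ (U (tail G e) xor U (head G e))) ≡ true
    crossing rewrite Fe | Uu | Ut = refl

  Connected⇒δ-nonempty : ∀ {J : EdgeSet G} → Connected G J → (U : NodeSet G) →
    Nonempty G U → Proper G U → 1 ℕ.≤ edgeCount (λ e → J e ∧ δ[_] G U e)
  Connected⇒δ-nonempty conn U (u , Uu) (w , Uw) =
    let (e , p) = Reach⇒δ-edge U (conn u w) Uu Uw in count-pos m _ e p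

  parity-deg : ∀ (J : EdgeSet G) v →
    parity (deg G J v) ≡ ∑[ e < m ] (J e ∧ (⌊ tail G e ≟ v ⌋ xor ⌊ head G e ≟ v ⌋))
  parity-deg J v = trans (parity-sumℕ m _) (sum-cong-≗ parity-term)
    where
    parity-term : ∀ e → parity (b2n (J e) ℕ.* (b2n ⌊ tail G e ≟ v ⌋ ℕ.+ b2n ⌊ head G e ≟ v ⌋))
                      ≡ J e ∧ (⌊ tail G e ≟ v ⌋ xor ⌊ head G e ≟ v ⌋)
    parity-term e = trans (parity-b2n-* (J e) _) (cong (J e ∧_) (begin
      parity (b2n atTail ℕ.+ b2n atHead)           ≡⟨ parity-+ (b2n atTail) (b2n atHead) ⟩
      parity (b2n atTail) xor parity (b2n atHead)  ≡⟨ cong₂ _xor_ (parity-b2n atTail) (parity-b2n atHead) ⟩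
      atTail xor atHead                            ∎))
      where
      atTail atHead : Bool
      atTail = ⌊ tail G e ≟ v ⌋
      atHead = ⌊ head G e ≟ v ⌋

  -- Each edge contributes to the degrees of both of its ends, so only the
  -- edges with exactly one end in U survive modulo 2.
  ∑-parity-deg≡∑-δ : ∀ (J : EdgeSet G) (U : NodeSet G) →
    ∑[ v < n ] (U v ∧ parity (deg G J v)) ≡ ∑[ e < m ] (J e ∧ δ[_] G U e)
  ∑-parity-deg≡∑-δ J U = begin
    ∑[ v < n ] (U v ∧ parity (deg G J v))
      ≡⟨ sum-cong-≗ (λ v → cong (U v ∧_) (parity-deg J v)) ⟩
    ∑[ v < n ] (U v ∧ ∑[ e < m ] incident v e)
      ≡⟨ sum-cong-≗ (λ v → *-distribˡ-sum (U v) (incident v)) ⟩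
    ∑[ v < n ] ∑[ e < m ] (U v ∧ incident v e)
      ≡⟨ ∑-comm (λ v e → U v ∧ incident v e) ⟩
    ∑[ e < m ] ∑[ v < n ] (U v ∧ incident v e)
      ≡⟨ sum-cong-≗ contribution ⟩
    ∑[ e < m ] (J e ∧ δ[_] G U e) ∎
    where
    incident : Fin n → Fin m → Bool
    incident v e = J e ∧ (⌊ tail G e ≟ v ⌋ xor ⌊ head G e ≟ v ⌋)

    open xor-∧-Solver
    regroup : ∀ u j t h → (u ∧ (j ∧ (t xor h))) ≡ (j ∧ ((t ∧ u) xor (h ∧ u)))
    regroup = solve 4 (λ u j t h → u :* (j :* (t :+ h)) := j :* (t :* u :+ h :* u)) refl

    contribution : ∀ e → ∑[ v < n ] (U v ∧ incident v e) ≡ J e ∧ δ[_] G U e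
    contribution e = begin
      ∑[ v < n ] (U v ∧ incident v e)
        ≡⟨ sum-cong-≗ (λ v → regroup (U v) (J e) ⌊ tail G e ≟ v ⌋ ⌊ head G e ≟ v ⌋) ⟩
      ∑[ v < n ] (J e ∧ (atTail v xor atHead v))
        ≡⟨ sym (*-distribˡ-sum (J e) (λ v → atTail v xor atHead v)) ⟩
      J e ∧ ∑[ v < n ] (atTail v xor atHead v)
        ≡⟨ cong (J e ∧_) (∑-distrib-+ atTail atHead) ⟩
      J e ∧ (∑[ v < n ] atTail v xor ∑[ v < n ] atHead v)
        ≡⟨ cong (J e ∧_) (cong₂ _xor_ (∑-indicator (tail G e) U) (∑-indicator (head G e) U)) ⟩
      J e ∧ δ[_] G U e ∎
      where
      atTail atHead : Fin n → Bool
      atTail v = ⌊ tail G e ≟ v ⌋ ∧ U v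
      atHead v = ⌊ head G e ≟ v ⌋ ∧ U v

  wrongDeg≡xor-parity-deg : ∀ (T : NodeSet G) (J : EdgeSet G) v →
    wrongDeg G T J v ≡ T v xor parity (deg G J v)
  wrongDeg≡xor-parity-deg T J v with T v
  ... | true  = isEven≡not-parity (deg G J v)
  ... | false = trans (cong not (isEven≡not-parity (deg G J v))) (not-involutive _)

  TOdd⇒∑≡true : ∀ (A U : NodeSet G) → TOdd G A U → ∑[ v < n ] (U v ∧ A v) ≡ true
  TOdd⇒∑≡true A U odd =
    trans (sym (parity-count n (λ v → U v ∧ A v)))
          (not-injective (trans (sym (isEven≡not-parity (cardInter G U A))) odd))

  TEven⇒∑≡false : ∀ (A U : NodeSet G) → TEven G A U → ∑[ v < n ] (U v ∧ A v) ≡ false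
  TEven⇒∑≡false A U even =
    trans (sym (parity-count n (λ v → U v ∧ A v)))
          (not-injective (trans (sym (isEven≡not-parity (cardInter G U A))) even))

  TOdd⇒Nonempty : ∀ (T U : NodeSet G) → TOdd G T U → Nonempty G U
  TOdd⇒Nonempty T U odd =
    let (v , p) = ∑≡true⇒∃ n _ (TOdd⇒∑≡true T U odd) in v , ∧-true⇒ˡ p

  -- The complement V ∖ U of a T-odd set is T-odd too, since T is even.
  TOdd⇒Proper : ∀ (T U : NodeSet G) → TEven G T (allV G) → TOdd G T U → Proper G U
  TOdd⇒Proper T U T-even odd =
    let (v , p) = ∑≡true⇒∃ n _ outside-odd in v , not-injective (∧-true⇒ˡ p)
    where
    split : ∀ v → T v ≡ (U v ∧ T v) xor (not (U v) ∧ T v)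
    split v = trans (cong (_∧ T v) (sym (xor-inverseʳ (U v)))) (∧-distribʳ-xor (T v) (U v) _)

    outside : Bool
    outside = ∑[ v < n ] (not (U v) ∧ T v)

    outside-odd : outside ≡ true
    outside-odd = not-injective (begin
      not outside                               ≡⟨ sym (true-xor outside) ⟩
      true xor outside                          ≡⟨ cong (_xor outside) (sym (TOdd⇒∑≡true T U odd)) ⟩
      ∑[ v < n ] (U v ∧ T v) xor outside
        ≡⟨ sym (∑-distrib-+ (λ v → U v ∧ T v) (λ v → not (U v) ∧ T v)) ⟩
      ∑[ v < n ] ((U v ∧ T v) xor (not (U v) ∧ T v))
                                                ≡⟨ sym (sum-cong-≗ split) ⟩
      ∑[ v < n ] T v                            ≡⟨ TEven⇒∑≡false T (allV G) T-even ⟩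
      false ∎)

  TOdd-DOdd⇒δ-even : ∀ (T : NodeSet G) (J : EdgeSet G) (U : NodeSet G) →
    TOdd G T U → TOdd G (wrongDeg G T J) U →
    parity (edgeCount (λ e → J e ∧ δ[_] G U e)) ≡ false
  TOdd-DOdd⇒δ-even T J U T-odd D-odd = begin
    parity (edgeCount (λ e → J e ∧ δ[_] G U e))  ≡⟨ parity-count m _ ⟩
    ∑[ e < m ] (J e ∧ δ[_] G U e)                ≡⟨ sym (∑-parity-deg≡∑-δ J U) ⟩
    oddDegrees                                   ≡⟨ not-injective (begin
      not false                                    ≡⟨ sym (TOdd⇒∑≡true (wrongDeg G T J) U D-odd) ⟩
      ∑[ v < n ] (U v ∧ wrongDeg G T J v)          ≡⟨ wrong≡T-xor-odd ⟩
      ∑[ v < n ] (U v ∧ T v) xor oddDegrees        ≡⟨ cong (_xor oddDegrees) (TOdd⇒∑≡true T U T-odd) ⟩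
      true xor oddDegrees                          ≡⟨ true-xor oddDegrees ⟩
      not oddDegrees                               ∎) ⟨
    false ∎
    where
    oddDegrees : Bool
    oddDegrees = ∑[ v < n ] (U v ∧ parity (deg G J v))

    wrong≡T-xor-odd : ∑[ v < n ] (U v ∧ wrongDeg G T J v) ≡ ∑[ v < n ] (U v ∧ T v) xor oddDegrees
    wrong≡T-xor-odd =
      trans (sum-cong-≗ (λ v → trans (cong (U v ∧_) (wrongDeg≡xor-parity-deg T J v))
                                     (∧-distribˡ-xor (U v) (T v) _)))
            (∑-distrib-+ (λ v → U v ∧ T v) (λ v → U v ∧ parity (deg G J v)))

  AppearsInTreeDecomp⇒Connected : ∀ {x : EdgeVec G} {J : EdgeSet G} →
    AppearsInTreeDecomp G x J → Connected G J
  AppearsInTreeDecomp⇒Connected decomp u v =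
    Reach-mono (λ e p → trans (sym (isJ e)) p) (proj₁ (isTree index) u v)
    where open AppearsInTreeDecomp decomp

1≤a*k+b*x⇐1≤k∧2≤x : ∀ {a b k x} → 0ℚ ≤ a → 0ℚ < b → 1ℚ ≤ a + ℕ→ℚ 2 * b →
  1ℚ ≤ k → ℕ→ℚ 2 ≤ x → 1ℚ ≤ a * k + b * x
1≤a*k+b*x⇐1≤k∧2≤x {a} {b} {k} {x} a≥0 b>0 1≤a+2b 1≤k 2≤x = begin
  1ℚ                   ≤⟨ 1≤a+2b ⟩
  a + ℕ→ℚ 2 * b        ≡⟨ cong₂ _+_ (sym (ℚ.*-identityʳ a)) (ℚ.*-comm (ℕ→ℚ 2) b) ⟩
  a * 1ℚ + b * ℕ→ℚ 2   ≤⟨ ℚ.+-mono-≤ (ℚ.*-monoˡ-≤-nonNeg a {{nonNegative a≥0}} 1≤k)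
                                    (ℚ.*-monoˡ-≤-nonNeg b {{ℚ.pos⇒nonNeg b {{positive b>0}}}} 2≤x) ⟩
  a * k + b * x        ∎
  where open ℚ.≤-Reasoning

*-divPos : ∀ p b (b>0 : 0ℚ < b) → b * divPos p b b>0 ≡ p
*-divPos p b b>0 = begin
  b * (p * 1/ b)  ≡⟨ ℚ.*-assoc b p _ ⟨
  (b * p) * 1/ b  ≡⟨ cong (_* 1/ b) (ℚ.*-comm b p) ⟩
  (p * b) * 1/ b  ≡⟨ ℚ.*-assoc p b _ ⟩
  p * (b * 1/ b)  ≡⟨ cong (p *_) (ℚ.*-inverseʳ b) ⟩
  p * 1ℚ          ≡⟨ ℚ.*-identityʳ p ⟩
  p               ∎
  where
  open ≡-Reasoning
  instance _ = ℚ.pos⇒nonZero b {{positive b>0}}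

1≤a*k+b*x⇐2≤k∧[1-2a]/b≤x : ∀ {a b k x} → 0ℚ ≤ a → (b>0 : 0ℚ < b) →
  ℕ→ℚ 2 ≤ k → divPos (1ℚ - ℕ→ℚ 2 * a) b b>0 ≤ x → 1ℚ ≤ a * k + b * x
1≤a*k+b*x⇐2≤k∧[1-2a]/b≤x {a} {b} {k} {x} a≥0 b>0 2≤k bound≤x = begin
  1ℚ                                    ≡⟨ split a (ℕ→ℚ 2) ⟨
  a * ℕ→ℚ 2 + (1ℚ - ℕ→ℚ 2 * a)          ≡⟨ cong (a * ℕ→ℚ 2 +_) (*-divPos _ b b>0) ⟨
  a * ℕ→ℚ 2 + b * divPos (1ℚ - ℕ→ℚ 2 * a) b b>0
    ≤⟨ ℚ.+-mono-≤ (ℚ.*-monoˡ-≤-nonNeg a {{nonNegative a≥0}} 2≤k)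
                  (ℚ.*-monoˡ-≤-nonNeg b {{ℚ.pos⇒nonNeg b {{positive b>0}}}} bound≤x) ⟩
  a * k + b * x                         ∎
  where
  open ℚ.≤-Reasoning
  open +-*-Solver
  split : ∀ a c → a * c + (1ℚ - c * a) ≡ 1ℚ
  split = solve 2 (λ a c → a :* c :+ (con 1ℚ :- c :* a) := con 1ℚ) refl

mainTheorem5 : (G : Graph) → (c : EdgeVec G) → (∀ e → 0ℚ ≤ c e) →
    (T : NodeSet G) → TEven G T (allV G) → (x : EdgeVec G) → LP1Optimal G c T x →
    (J : EdgeSet G) → AppearsInTreeDecomp G x J →
    (α β : ℚ) → 0ℚ ≤ α → (βpos : 0ℚ < β) → 1ℚ ≤ α + (ℕ→ℚ 2) * β →
    (U : NodeSet G) →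
    ((TEven G T U × Nonempty G U × Proper G U)
    ⊎ (TOdd G T U × TOdd G (wrongDeg G T J) U ×
    divPos (1ℚ - (ℕ→ℚ 2) * α) β βpos ≤ _⟦_⟧ G x (δ[_] G U))) →
    1ℚ ≤ _⟦_⟧ G (λ e → α * χ G J e + β * x e) (δ[_] G U)
mainTheorem5 G _ _ T T-even x (feasible , _) J decomp α β α≥0 β>0 α+2β≥1 U cases =
  ℚ.≤-trans (bound cases) (ℚ.≤-reflexive (sym objective))
  where
  open LP1Feasible feasible using (cut)

  δU : EdgeSet G
  δU = δ[_] G U

  crossings : ℕ
  crossings = edgeCount G (λ e → J e ∧ δU e)

  objective : _⟦_⟧ G (λ e → α * χ G J e + β * x e) δU ≡ α * (crossings ×ℚ 1ℚ) + β * _⟦_⟧ G x δU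
  objective = trans (⟦⟧-linear G α β (χ G J) x δU)
                    (cong (λ k → α * k + β * _⟦_⟧ G x δU) (χ⟦⟧≡edgeCount G J δU))

  crossed : Nonempty G U → Proper G U → 1 ℕ.≤ crossings
  crossed = Connected⇒δ-nonempty G (AppearsInTreeDecomp⇒Connected G decomp) U

  bound : (TEven G T U × Nonempty G U × Proper G U)
        ⊎ (TOdd G T U × TOdd G (wrongDeg G T J) U ×
           divPos (1ℚ - ℕ→ℚ 2 * α) β β>0 ≤ _⟦_⟧ G x δU) →
          1ℚ ≤ α * (crossings ×ℚ 1ℚ) + β * _⟦_⟧ G x δU
  bound (inj₁ (U-even , U≠∅ , U≠V)) =
    1≤a*k+b*x⇐1≤k∧2≤x α≥0 β>0 α+2β≥1 (×ℚ1-mono-≤ (crossed U≠∅ U≠V)) (cut U U≠∅ U≠V U-even)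
  bound (inj₂ (U-odd , D-odd , x-bound)) =
    1≤a*k+b*x⇐2≤k∧[1-2a]/b≤x α≥0 β>0 (×ℚ1-mono-≤ (1≤even⇒2≤ (crossed U≠∅ U≠V) even)) x-bound
    where
    U≠∅ : Nonempty G U
    U≠∅ = TOdd⇒Nonempty G T U U-odd
    U≠V : Proper G U
    U≠V = TOdd⇒Proper G T U T-even U-odd
    even : parity crossings ≡ false
    even = TOdd-DOdd⇒δ-even G T J U U-odd D-odd
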